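{- Let $n$ be a nonnegative integer, let $A$ and $B$ be subsets of $\{0,1,\ldots,n\}$ with $|A|=|B|$, and let $A^{\mathsf c}$ and $B^{\mathsf c}$ be their complements in $\{0,1,\ldots,n\}$. Then \[ \det\left(\binom{b}{a}_q\right)_{a\in A,\,b\in B} = \det\left(q^{\binom{a'-b'}{2}}\binom{a'}{b'}_q\right)_{a'\in A^{\mathsf c},\,b'\in B^{\mathsf c}}. \]
   Context: Matrices indexed by finite subsets of $\mathbb Z$ have rows and columns ordered from smallest to largest element. $\binom{m}{k}_q$ denotes the $q$-binomial (Gaussian) coefficient, a polynomial in $q$, with $\binom{m}{k}_q=0$ unless $0\le k\le m$. For an integer $k$, $\binom{k}{2}=k(k-1)/2$. -}

module Defs where

open import Level using (Level)
open import Algebra.Bundles using (CommutativeRing)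
open import Data.Nat using (ℕ; zero; suc)
open import Data.Nat.Combinatorics using (_C_)
open import Data.Integer using (ℤ; +_; -[1+_]; _-_)
open import Data.Bool using (true; false)
open import Data.List using (List; []; _∷_; _++_; [_]; map)
open import Data.Vec using ([]; _∷_)
open import Data.Fin.Subset using (Subset)

-- binom(k,2) = k(k-1)/2 for an integer k (always a natural number)
binom2 : ℤ → ℕ
binom2 (+ d)       = d C 2
binom2 -[1+ e ]    = suc (suc e) C 2      -- k = -(e+1): k(k-1)/2 = (e+2)(e+1)/2

-- elements of a subset of {0,…,m-1} (Fin m ↔ toℕ), in increasing order
elems : ∀ {m} → Subset m → List ℕ
elems []            = []
elems (true  ∷ p)   = 0 ∷ map suc (elems p)
elems (false ∷ p)   = map suc (elems p)

module _ {c ℓ : Level} (R : CommutativeRing c ℓ) where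
  open CommutativeRing R

  pow : Carrier → ℕ → Carrier
  pow x zero    = 1#
  pow x (suc k) = x * pow x k

  qbinom : Carrier → ℕ → ℕ → Carrier
  qbinom q m       zero    = 1#
  qbinom q zero    (suc k) = 0#
  qbinom q (suc m) (suc k) = qbinom q m k + pow q (suc k) * qbinom q m (suc k)

  -- determinant of the matrix (f r c) with rows indexed by the list rs and
  -- columns by the list cs (in the given order), by Laplace expansion along
  -- the first row.  Meaningful when length rs = length cs.
  mutual
    detL : (ℕ → ℕ → Carrier) → List ℕ → List ℕ → Carrier
    detL f []       cs = 1#
    detL f (r ∷ rs) cs = lap f r rs [] cs

    lap : (ℕ → ℕ → Carrier) → ℕ → List ℕ → List ℕ → List ℕ → Carrier
    lap f r rs pre []         = 0#
    lap f r rs pre (c ∷ post) =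
      f r c * detL f rs (pre ++ post) + - lap f r rs (pre ++ [ c ]) post

  detSub : ∀ {m} → (ℕ → ℕ → Carrier) → Subset m → Subset m → Carrier
  detSub f A B = detL f (elems A) (elems B)

{-# OPTIONS --safe #-}
-- The lower unitriangular matrix ([a choose b]_q) has inverse ((-1)^(a+b) q^binom(a-b,2) [a choose b]_q),
-- and the identity is Jacobi's complementary-minor theorem for this pair. We prove it directly by
-- induction on the smallest index s. If s lies in both A and B (in neither), column s of the left
-- minor (row s of the right minor) is a unit vector. If s lies in B only, both minors vanish. If s
-- lies in A only, expand the left minor along row s; on the right, the inverse relation writes column
-- s as a combination of the later columns, and multilinearity produces the same sum of smaller minors.
module Submission where

open import Defs
open import Level using (Level)
open import Algebra.Bundles using (CommutativeRing)
open import Data.Nat using (ℕ; suc)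
open import Data.Integer using (+_; _-_)
open import Data.Fin.Subset using (Subset; ∁; ∣_∣)
open import Relation.Binary.PropositionalEquality using (_≡_)

open import Data.Nat using (zero; _<_; _≤_; s≤s; z≤n; _<?_)
import Data.Nat as ℕ
import Data.Nat.Properties as ℕₚ
open import Data.Nat.Combinatorics using (_C_; nCk+nC[k+1]≡[n+1]C[k+1]; nC1≡n)
open import Data.Integer using (ℤ; -[1+_])
import Data.Integer as ℤ
import Data.Integer.Properties as ℤₚ
open import Data.Sign using (Sign)
import Data.Sign as Sign
open import Data.Bool using (true; false)
open import Data.Vec using ([]; _∷_)
open import Data.List using (List; []; _∷_; _++_; [_]; map; length)
import Data.List.Properties as Listₚ
open import Data.List.Relation.Unary.All as All using (All; []; _∷_)
open import Data.List.Relation.Unary.All.Properties using (map⁺)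
open import Data.Fin.Subset.Properties using (∣∁p∣≡n∸∣p∣)
open import Data.Product using (_×_; _,_; proj₁)
import Data.Maybe as Maybe
open import Relation.Binary.Consequences using (dec⇒weaklyDec)
open import Relation.Nullary using (yes; no)
import Relation.Binary.PropositionalEquality as ≡
open import Algebra.Solver.Ring.AlmostCommutativeRing
  using (fromCommutativeRing; _-Raw-AlmostCommutative⟶_)

module IntegerCoefficients {c ℓ : Level} (R : CommutativeRing c ℓ) where
  open CommutativeRing R hiding (zero)
  open import Algebra.Properties.Ring ring using (-‿involutive; -0#≈0#; -1*x≈-x; -‿+-comm)
  open import Algebra.Properties.CommutativeSemigroup *-commutativeSemigroup using (interchange)
  open import Algebra.Properties.Semiring.Mult semiring using (×-homo-+; ×1-homo-*) renaming (_×_ to _·_)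
  open import Relation.Binary.Reasoning.Setoid setoid

  fromℕ : ℕ → Carrier
  fromℕ n = n · 1#

  fromℤ : ℤ → Carrier
  fromℤ (+ n)    = fromℕ n
  fromℤ -[1+ n ] = - fromℕ (suc n)

  fromSign : Sign → Carrier
  fromSign Sign.+ = 1#
  fromSign Sign.- = - 1#

  fromℤ-⊖ : ∀ m n → fromℤ (m ℤ.⊖ n) ≈ fromℕ m + - fromℕ n
  fromℤ-⊖ zero    zero    = sym (trans (+-congˡ -0#≈0#) (+-identityʳ _))
  fromℤ-⊖ zero    (suc n) = sym (+-identityˡ _)
  fromℤ-⊖ (suc m) zero    = sym (trans (+-congˡ -0#≈0#) (+-identityʳ _))
  fromℤ-⊖ (suc m) (suc n) = begin
    fromℤ (suc m ℤ.⊖ suc n)                  ≡⟨ ≡.cong fromℤ (ℤₚ.[1+m]⊖[1+n]≡m⊖n m n) ⟩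
    fromℤ (m ℤ.⊖ n)                          ≈⟨ fromℤ-⊖ m n ⟩
    fromℕ m + - fromℕ n                      ≈⟨ sym (+-identityˡ _) ⟩
    0# + (fromℕ m + - fromℕ n)               ≈⟨ +-congʳ (sym (-‿inverseʳ 1#)) ⟩
    (1# + - 1#) + (fromℕ m + - fromℕ n)      ≈⟨ +-assoc _ _ _ ⟩
    1# + (- 1# + (fromℕ m + - fromℕ n))      ≈⟨ +-congˡ (trans (sym (+-assoc _ _ _)) (trans (+-congʳ (+-comm _ _)) (+-assoc _ _ _))) ⟩
    1# + (fromℕ m + (- 1# + - fromℕ n))      ≈⟨ sym (+-assoc _ _ _) ⟩
    (1# + fromℕ m) + (- 1# + - fromℕ n)      ≈⟨ +-congˡ (-‿+-comm _ _) ⟩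
    (1# + fromℕ m) + - (1# + fromℕ n)        ∎

  fromℤ-+ : ∀ i j → fromℤ (i ℤ.+ j) ≈ fromℤ i + fromℤ j
  fromℤ-+ (+ m)    (+ n)    = ×-homo-+ 1# m n
  fromℤ-+ (+ m)    -[1+ n ] = fromℤ-⊖ m (suc n)
  fromℤ-+ -[1+ m ] (+ n)    = trans (fromℤ-⊖ n (suc m)) (+-comm _ _)
  fromℤ-+ -[1+ m ] -[1+ n ] = begin
    - fromℕ (suc (suc (m ℕ.+ n)))           ≡⟨ ≡.cong (λ k → - fromℕ (suc k)) (≡.sym (ℕₚ.+-suc m n)) ⟩
    - fromℕ (suc m ℕ.+ suc n)               ≈⟨ -‿cong (×-homo-+ 1# (suc m) (suc n)) ⟩
    - (fromℕ (suc m) + fromℕ (suc n))       ≈⟨ sym (-‿+-comm _ _) ⟩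
    - fromℕ (suc m) + - fromℕ (suc n)       ∎

  fromℤ-◃ : ∀ s n → fromℤ (s ℤ.◃ n) ≈ fromSign s * fromℕ n
  fromℤ-◃ s      zero    = sym (zeroʳ _)
  fromℤ-◃ Sign.+ (suc n) = sym (*-identityˡ _)
  fromℤ-◃ Sign.- (suc n) = sym (-1*x≈-x _)

  fromSign-* : ∀ s t → fromSign (s Sign.* t) ≈ fromSign s * fromSign t
  fromSign-* Sign.+ Sign.+ = sym (*-identityˡ _)
  fromSign-* Sign.+ Sign.- = sym (*-identityˡ _)
  fromSign-* Sign.- Sign.+ = sym (*-identityʳ _)
  fromSign-* Sign.- Sign.- = sym (trans (-1*x≈-x _) (-‿involutive _))

  fromℤ-signAbs : ∀ i → fromℤ i ≈ fromSign (ℤ.sign i) * fromℕ ℤ.∣ i ∣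
  fromℤ-signAbs i = trans (reflexive (≡.cong fromℤ (≡.sym (ℤₚ.◃-inverse i)))) (fromℤ-◃ (ℤ.sign i) ℤ.∣ i ∣)

  fromℤ-* : ∀ i j → fromℤ (i ℤ.* j) ≈ fromℤ i * fromℤ j
  fromℤ-* i j = begin
    fromℤ (i ℤ.* j)
      ≈⟨ fromℤ-◃ (ℤ.sign i Sign.* ℤ.sign j) (ℤ.∣ i ∣ ℕ.* ℤ.∣ j ∣) ⟩
    fromSign (ℤ.sign i Sign.* ℤ.sign j) * fromℕ (ℤ.∣ i ∣ ℕ.* ℤ.∣ j ∣)
      ≈⟨ *-cong (fromSign-* (ℤ.sign i) (ℤ.sign j)) (×1-homo-* ℤ.∣ i ∣ ℤ.∣ j ∣) ⟩
    (fromSign (ℤ.sign i) * fromSign (ℤ.sign j)) * (fromℕ ℤ.∣ i ∣ * fromℕ ℤ.∣ j ∣)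
      ≈⟨ interchange _ _ _ _ ⟩
    (fromSign (ℤ.sign i) * fromℕ ℤ.∣ i ∣) * (fromSign (ℤ.sign j) * fromℕ ℤ.∣ j ∣)
      ≈⟨ sym (*-cong (fromℤ-signAbs i) (fromℤ-signAbs j)) ⟩
    fromℤ i * fromℤ j ∎

  fromℤ-neg : ∀ i → fromℤ (ℤ.- i) ≈ - fromℤ i
  fromℤ-neg -[1+ n ]     = sym (-‿involutive _)
  fromℤ-neg (+ zero)     = sym -0#≈0#
  fromℤ-neg (+ (suc n))  = refl

  homomorphism : ℤ.+-*-rawRing -Raw-AlmostCommutative⟶ fromCommutativeRing R
  homomorphism = record
    { ⟦_⟧ = fromℤ ; +-homo = fromℤ-+ ; *-homo = fromℤ-* ; -‿homo = fromℤ-neg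
    ; 0-homo = refl ; 1-homo = +-identityʳ 1# }

-- Integer rather than R-valued coefficients: the solver compares normal forms syntactically, so
-- coefficient arithmetic such as (-1) * (-1) = 1 must compute.
module RingSolver {c ℓ : Level} (R : CommutativeRing c ℓ) where
  open CommutativeRing R using (reflexive)
  open IntegerCoefficients R

  open import Algebra.Solver.Ring ℤ.+-*-rawRing (fromCommutativeRing R) homomorphism
    (λ i j → Maybe.map (λ i≡j → reflexive (≡.cong fromℤ i≡j)) (dec⇒weaklyDec ℤ._≟_ i j)) public
    using (solve; _:=_; _:+_; _:*_; :-_; con)

module Signs {c ℓ : Level} (R : CommutativeRing c ℓ) where
  open CommutativeRing R hiding (zero)
  open import Algebra.Properties.Ring ring using (-‿distribˡ-*)
  open RingSolver R

  sign : ℕ → Carrier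
  sign zero    = 1#
  sign (suc k) = - sign k

  sign-+ : ∀ m n → sign (m ℕ.+ n) ≈ sign m * sign n
  sign-+ zero    n = sym (*-identityˡ _)
  sign-+ (suc m) n = trans (-‿cong (sign-+ m n)) (-‿distribˡ-* _ _)

  sign-square : ∀ m → sign m * sign m ≈ 1#
  sign-square zero    = *-identityˡ _
  sign-square (suc m) = trans (solve 1 (λ x → :- x :* :- x := x :* x) refl (sign m)) (sign-square m)

module Sums {c ℓ : Level} (R : CommutativeRing c ℓ) where
  open CommutativeRing R hiding (zero)
  open import Relation.Binary.Reasoning.Setoid setoid
  open RingSolver R

  sumFrom : ℕ → ℕ → (ℕ → Carrier) → Carrier
  sumFrom u zero    g = 0#
  sumFrom u (suc j) g = g u + sumFrom (suc u) j g

  sumFrom-suc : ∀ u j g → sumFrom (suc u) j g ≡ sumFrom u j (λ b → g (suc b))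
  sumFrom-suc u zero    g = ≡.refl
  sumFrom-suc u (suc j) g = ≡.cong (λ s → g (suc u) + s) (sumFrom-suc (suc u) j g)

  sumFrom-cong : ∀ u j {g h} → (∀ b → u ≤ b → g b ≈ h b) → sumFrom u j g ≈ sumFrom u j h
  sumFrom-cong u zero    e = refl
  sumFrom-cong u (suc j) e = +-cong (e u ℕₚ.≤-refl) (sumFrom-cong (suc u) j (λ b u<b → e b (ℕₚ.<⇒≤ u<b)))

  sumFrom-+ : ∀ u j g h → sumFrom u j (λ b → g b + h b) ≈ sumFrom u j g + sumFrom u j h
  sumFrom-+ u zero    g h = sym (+-identityʳ _)
  sumFrom-+ u (suc j) g h = trans (+-congˡ (sumFrom-+ (suc u) j g h))
    (solve 4 (λ a b x y → (a :+ b) :+ (x :+ y) := (a :+ x) :+ (b :+ y)) refl _ _ _ _)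

  sumFrom-*ˡ : ∀ u j k g → sumFrom u j (λ b → k * g b) ≈ k * sumFrom u j g
  sumFrom-*ˡ u zero    k g = sym (zeroʳ _)
  sumFrom-*ˡ u (suc j) k g = trans (+-congˡ (sumFrom-*ˡ (suc u) j k g)) (sym (distribˡ _ _ _))

  sumFrom-zero : ∀ u j g → (∀ b → b < u ℕ.+ j → g b ≈ 0#) → sumFrom u j g ≈ 0#
  sumFrom-zero u zero    g z = refl
  sumFrom-zero u (suc j) g z = trans
    (+-cong (z u (ℕₚ.m<m+n u (s≤s z≤n)))
            (sumFrom-zero (suc u) j g (λ b b< → z b (≡.subst (b <_) (≡.sym (ℕₚ.+-suc u j)) b<))))
    (+-identityʳ _)

  sumFrom-split : ∀ m u j g → sumFrom u (m ℕ.+ j) g ≈ sumFrom u m g + sumFrom (u ℕ.+ m) j g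
  sumFrom-split zero    u j g =
    trans (reflexive (≡.cong (λ v → sumFrom v j g) (≡.sym (ℕₚ.+-identityʳ u)))) (sym (+-identityˡ _))
  sumFrom-split (suc m) u j g = begin
    g u + sumFrom (suc u) (m ℕ.+ j) g                   ≈⟨ +-congˡ (sumFrom-split m (suc u) j g) ⟩
    g u + (sumFrom (suc u) m g + sumFrom (suc u ℕ.+ m) j g) ≈⟨ sym (+-assoc _ _ _) ⟩
    (g u + sumFrom (suc u) m g) + sumFrom (suc u ℕ.+ m) j g ≡⟨ ≡.cong (λ v → (g u + sumFrom (suc u) m g) + sumFrom v j g) (≡.sym (ℕₚ.+-suc u m)) ⟩
    (g u + sumFrom (suc u) m g) + sumFrom (u ℕ.+ suc m) j g ∎

module Determinant {c ℓ : Level} (R : CommutativeRing c ℓ) (I : Set) where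
  open CommutativeRing R hiding (zero)
  open import Algebra.Properties.Ring ring using (-0#≈0#; -‿distribˡ-*)
  open import Relation.Binary.Reasoning.Setoid setoid
  open RingSolver R
  open Signs R
  open Sums R

  Column : Set c
  Column = I → Carrier

  -- expand r rs P Q is the part of the expansion of det (r ∷ rs) (P ++ Q) along its first row
  -- contributed by the columns Q, the sign of the first of them counted as positive.
  mutual
    det : List I → List Column → Carrier
    det []       []      = 1#
    det []       (_ ∷ _) = 0#
    det (r ∷ rs) cs      = expand r rs [] cs

    expand : I → List I → List Column → List Column → Carrier
    expand r rs P []      = 0#
    expand r rs P (v ∷ Q) = v r * det rs (P ++ Q) + - expand r rs (P ++ [ v ]) Q

  det-≡ : ∀ rs {P Q} → P ≡ Q → det rs P ≈ det rs Q
  det-≡ rs e = reflexive (≡.cong (det rs) e)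

  expand-≡ : ∀ r rs {P P′} Q → P ≡ P′ → expand r rs P Q ≈ expand r rs P′ Q
  expand-≡ r rs Q e = reflexive (≡.cong (λ P → expand r rs P Q) e)

  private
    term-zero : ∀ a x e → x ≈ 0# → e ≈ 0# → a * x + - e ≈ 0#
    term-zero a x e x≈0 e≈0 = trans (+-cong (*-congˡ x≈0) (-‿cong e≈0))
      (solve 1 (λ a → a :* con (+ 0) :+ :- con (+ 0) := con (+ 0)) refl a)

    term-neg : ∀ a x x′ e e′ → x ≈ - x′ → e ≈ - e′ → a * x + - e ≈ - (a * x′ + - e′)
    term-neg a x x′ e e′ x≈ e≈ = trans (+-cong (*-congˡ x≈) (-‿cong e≈))
      (solve 3 (λ a x e → a :* (:- x) :+ :- (:- e) := :- (a :* x :+ :- e)) refl a x′ e′)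

    minus-zero : ∀ x → x + - 0# ≈ x
    minus-zero x = trans (+-congˡ -0#≈0#) (+-identityʳ x)

  expand-zeroRow : ∀ r rs P cs → All (λ v → v r ≈ 0#) cs → expand r rs P cs ≈ 0#
  expand-zeroRow r rs P []      []       = refl
  expand-zeroRow r rs P (v ∷ Q) (z ∷ zs) =
    trans (+-cong (*-congʳ z) (-‿cong (expand-zeroRow r rs (P ++ [ v ]) Q zs)))
          (trans (+-congʳ (zeroˡ _)) (minus-zero 0#))

  det-zeroRow : ∀ r rs cs → All (λ v → v r ≈ 0#) cs → det (r ∷ rs) cs ≈ 0#
  det-zeroRow r rs cs = expand-zeroRow r rs [] cs

  det-headRow : ∀ r rs u Q → All (λ v → v r ≈ 0#) Q → det (r ∷ rs) (u ∷ Q) ≈ u r * det rs Q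
  det-headRow r rs u Q zs = trans (+-congˡ (-‿cong (expand-zeroRow r rs [ u ] Q zs))) (minus-zero _)

  mutual
    det-+-head : ∀ rs u v Q → det rs ((λ r → u r + v r) ∷ Q) ≈ det rs (u ∷ Q) + det rs (v ∷ Q)
    det-+-head []       u v Q = sym (+-identityʳ _)
    det-+-head (r ∷ rs) u v Q = begin
      (u r + v r) * det rs Q + - expand r rs [ (λ r → u r + v r) ] Q
        ≈⟨ +-congˡ (-‿cong (expand-+-head r rs u v [] Q)) ⟩
      (u r + v r) * det rs Q + - (expand r rs [ u ] Q + expand r rs [ v ] Q)
        ≈⟨ solve 5 (λ a b d x y → (a :+ b) :* d :+ :- (x :+ y) := (a :* d :+ :- x) :+ (b :* d :+ :- y)) refl _ _ _ _ _ ⟩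
      (u r * det rs Q + - expand r rs [ u ] Q) + (v r * det rs Q + - expand r rs [ v ] Q) ∎

    expand-+-head : ∀ r rs u v P Q →
      expand r rs ((λ r → u r + v r) ∷ P) Q ≈ expand r rs (u ∷ P) Q + expand r rs (v ∷ P) Q
    expand-+-head r rs u v P []      = sym (+-identityʳ _)
    expand-+-head r rs u v P (x ∷ Q) = trans
      (+-cong (*-congˡ (det-+-head rs u v (P ++ Q))) (-‿cong (expand-+-head r rs u v (P ++ [ x ]) Q)))
      (solve 5 (λ a d₁ d₂ e₁ e₂ → a :* (d₁ :+ d₂) :+ :- (e₁ :+ e₂) := (a :* d₁ :+ :- e₁) :+ (a :* d₂ :+ :- e₂)) refl _ _ _ _ _)

  mutual
    det-*-head : ∀ rs k u Q → det rs ((λ r → k * u r) ∷ Q) ≈ k * det rs (u ∷ Q)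
    det-*-head []       k u Q = sym (zeroʳ _)
    det-*-head (r ∷ rs) k u Q = trans
      (+-congˡ (-‿cong (expand-*-head r rs k u [] Q)))
      (solve 4 (λ k a d e → (k :* a) :* d :+ :- (k :* e) := k :* (a :* d :+ :- e)) refl _ _ _ _)

    expand-*-head : ∀ r rs k u P Q → expand r rs ((λ r → k * u r) ∷ P) Q ≈ k * expand r rs (u ∷ P) Q
    expand-*-head r rs k u P []      = sym (zeroʳ _)
    expand-*-head r rs k u P (x ∷ Q) = trans
      (+-cong (*-congˡ (det-*-head rs k u (P ++ Q))) (-‿cong (expand-*-head r rs k u (P ++ [ x ]) Q)))
      (solve 4 (λ a k d e → a :* (k :* d) :+ :- (k :* e) := k :* (a :* d :+ :- e)) refl _ _ _ _)

  mutual
    det-cong-head : ∀ rs u v Q → All (λ r → u r ≈ v r) rs → det rs (u ∷ Q) ≈ det rs (v ∷ Q)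
    det-cong-head []       u v Q []       = refl
    det-cong-head (r ∷ rs) u v Q (e ∷ es) = +-cong (*-congʳ e) (-‿cong (expand-cong-head r rs u v [] Q es))

    expand-cong-head : ∀ r rs u v P Q → All (λ r → u r ≈ v r) rs → expand r rs (u ∷ P) Q ≈ expand r rs (v ∷ P) Q
    expand-cong-head r rs u v P []      es = refl
    expand-cong-head r rs u v P (x ∷ Q) es =
      +-cong (*-congˡ (det-cong-head rs u v (P ++ Q) es)) (-‿cong (expand-cong-head r rs u v (P ++ [ x ]) Q es))

  det-zeroColumn : ∀ rs u Q → All (λ r → u r ≈ 0#) rs → det rs (u ∷ Q) ≈ 0#
  det-zeroColumn rs u Q zs = begin
    det rs (u ∷ Q)                  ≈⟨ det-cong-head rs u (λ r → 0# * u r) Q (All.map (λ z → trans z (sym (zeroˡ _))) zs) ⟩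
    det rs ((λ r → 0# * u r) ∷ Q)   ≈⟨ det-*-head rs 0# u Q ⟩
    0# * det rs (u ∷ Q)             ≈⟨ zeroˡ _ ⟩
    0#                              ∎

  expand-zeroColumn : ∀ r rs u P Q → All (λ r → u r ≈ 0#) rs → expand r rs (u ∷ P) Q ≈ 0#
  expand-zeroColumn r rs u P []      zs = refl
  expand-zeroColumn r rs u P (x ∷ Q) zs =
    term-zero (x r) _ _ (det-zeroColumn rs u (P ++ Q) zs) (expand-zeroColumn r rs u (P ++ [ x ]) Q zs)

  det-headColumn : ∀ r rs u Q → All (λ r → u r ≈ 0#) rs → det (r ∷ rs) (u ∷ Q) ≈ u r * det rs Q
  det-headColumn r rs u Q zs = trans (+-congˡ (-‿cong (expand-zeroColumn r rs u [] Q zs))) (minus-zero _)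

  det-sum-head : ∀ rs u j (w : ℕ → Carrier) (V : ℕ → Column) Q →
    det rs ((λ r → sumFrom u j (λ b → w b * V b r)) ∷ Q) ≈ sumFrom u j (λ b → w b * det rs (V b ∷ Q))
  det-sum-head rs u zero    w V Q = det-zeroColumn rs _ Q (All.tabulate (λ _ → refl))
  det-sum-head rs u (suc j) w V Q = begin
    det rs ((λ r → w u * V u r + sumFrom (suc u) j (λ b → w b * V b r)) ∷ Q)
      ≈⟨ det-+-head rs (λ r → w u * V u r) (λ r → sumFrom (suc u) j (λ b → w b * V b r)) Q ⟩
    det rs ((λ r → w u * V u r) ∷ Q) + det rs ((λ r → sumFrom (suc u) j (λ b → w b * V b r)) ∷ Q)
      ≈⟨ +-cong (det-*-head rs (w u) (V u) Q) (det-sum-head rs (suc u) j w V Q) ⟩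
    w u * det rs (V u ∷ Q) + sumFrom (suc u) j (λ b → w b * det rs (V b ∷ Q)) ∎

  private
    ++-assoc₃ : ∀ (Y : List Column) u v Z Q → (Y ++ u ∷ v ∷ Z) ++ Q ≡ Y ++ u ∷ v ∷ (Z ++ Q)
    ++-assoc₃ Y u v Z Q = Listₚ.++-assoc Y (u ∷ v ∷ Z) Q

  mutual
    det-swap : ∀ rs P u v Q → det rs (P ++ u ∷ v ∷ Q) ≈ - det rs (P ++ v ∷ u ∷ Q)
    det-swap []       []      u v Q = sym -0#≈0#
    det-swap []       (_ ∷ _) u v Q = sym -0#≈0#
    det-swap (r ∷ rs) P       u v Q = expand-swap r rs [] P u v Q

    expand-swap : ∀ r rs X P u v Q → expand r rs X (P ++ u ∷ v ∷ Q) ≈ - expand r rs X (P ++ v ∷ u ∷ Q)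
    expand-swap r rs X (x ∷ P) u v Q = term-neg (x r) _ _ _ _
      (trans (det-≡ rs (≡.sym (Listₚ.++-assoc X P (u ∷ v ∷ Q))))
        (trans (det-swap rs (X ++ P) u v Q) (-‿cong (det-≡ rs (Listₚ.++-assoc X P (v ∷ u ∷ Q))))))
      (expand-swap r rs (X ++ [ x ]) P u v Q)
    expand-swap r rs X [] u v Q = begin
      u r * det rs (X ++ v ∷ Q) + - (v r * det rs ((X ++ [ u ]) ++ Q) + - expand r rs ((X ++ [ u ]) ++ [ v ]) Q)
        ≈⟨ +-congˡ (-‿cong (+-cong (*-congˡ (det-≡ rs (Listₚ.++-assoc X [ u ] Q)))
             (-‿cong (trans (expand-≡ r rs Q (Listₚ.++-assoc X [ u ] [ v ])) (expand-swap-passed r rs X u v [] Q))))) ⟩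
      u r * det rs (X ++ v ∷ Q) + - (v r * det rs (X ++ u ∷ Q) + - - expand r rs (X ++ v ∷ u ∷ []) Q)
        ≈⟨ solve 5 (λ a b d₁ d₂ e → a :* d₁ :+ :- (b :* d₂ :+ :- (:- e)) := :- (b :* d₂ :+ :- (a :* d₁ :+ :- e))) refl _ _ _ _ _ ⟩
      - (v r * det rs (X ++ u ∷ Q) + - (u r * det rs (X ++ v ∷ Q) + - expand r rs (X ++ v ∷ u ∷ []) Q))
        ≈⟨ -‿cong (+-congˡ (-‿cong (+-cong (*-congˡ (det-≡ rs (≡.sym (Listₚ.++-assoc X [ v ] Q))))
             (-‿cong (expand-≡ r rs Q (≡.sym (Listₚ.++-assoc X [ v ] [ u ]))))))) ⟩
      - (v r * det rs (X ++ u ∷ Q) + - (u r * det rs ((X ++ [ v ]) ++ Q) + - expand r rs ((X ++ [ v ]) ++ [ u ]) Q)) ∎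

    expand-swap-passed : ∀ r rs Y u v Z Q → expand r rs (Y ++ u ∷ v ∷ Z) Q ≈ - expand r rs (Y ++ v ∷ u ∷ Z) Q
    expand-swap-passed r rs Y u v Z []      = sym -0#≈0#
    expand-swap-passed r rs Y u v Z (x ∷ Q) = term-neg (x r) _ _ _ _
      (trans (det-≡ rs (++-assoc₃ Y u v Z Q))
        (trans (det-swap rs Y u v (Z ++ Q)) (-‿cong (det-≡ rs (≡.sym (++-assoc₃ Y v u Z Q))))))
      (trans (expand-≡ r rs Q (++-assoc₃ Y u v Z [ x ]))
        (trans (expand-swap-passed r rs Y u v (Z ++ [ x ]) Q)
               (-‿cong (expand-≡ r rs Q (≡.sym (++-assoc₃ Y v u Z [ x ]))))))

  mutual
    det-dup : ∀ rs P u Q → det rs (P ++ u ∷ u ∷ Q) ≈ 0#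
    det-dup []       []      u Q = refl
    det-dup []       (_ ∷ _) u Q = refl
    det-dup (r ∷ rs) P       u Q = expand-dup r rs [] P u Q

    expand-dup : ∀ r rs X P u Q → expand r rs X (P ++ u ∷ u ∷ Q) ≈ 0#
    expand-dup r rs X (x ∷ P) u Q = term-zero (x r) _ _
      (trans (det-≡ rs (≡.sym (Listₚ.++-assoc X P (u ∷ u ∷ Q)))) (det-dup rs (X ++ P) u Q))
      (expand-dup r rs (X ++ [ x ]) P u Q)
    expand-dup r rs X [] u Q = begin
      u r * det rs (X ++ u ∷ Q) + - (u r * det rs ((X ++ [ u ]) ++ Q) + - expand r rs ((X ++ [ u ]) ++ [ u ]) Q)
        ≈⟨ +-congˡ (-‿cong (+-cong (*-congˡ (det-≡ rs (Listₚ.++-assoc X [ u ] Q)))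
             (-‿cong (trans (expand-≡ r rs Q (Listₚ.++-assoc X [ u ] [ u ])) (expand-dup-passed r rs X u [] Q))))) ⟩
      u r * det rs (X ++ u ∷ Q) + - (u r * det rs (X ++ u ∷ Q) + - 0#)
        ≈⟨ solve 1 (λ a → a :+ :- (a :+ :- con (+ 0)) := con (+ 0)) refl _ ⟩
      0# ∎

    expand-dup-passed : ∀ r rs Y u Z Q → expand r rs (Y ++ u ∷ u ∷ Z) Q ≈ 0#
    expand-dup-passed r rs Y u Z []      = refl
    expand-dup-passed r rs Y u Z (x ∷ Q) = term-zero (x r) _ _
      (trans (det-≡ rs (++-assoc₃ Y u u Z Q)) (det-dup rs Y u (Z ++ Q)))
      (trans (expand-≡ r rs Q (++-assoc₃ Y u u Z [ x ])) (expand-dup-passed r rs Y u (Z ++ [ x ]) Q))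

  det-move : ∀ rs P v Q S → det rs (P ++ v ∷ (Q ++ S)) ≈ sign (length Q) * det rs (P ++ Q ++ v ∷ S)
  det-move rs P v []      S = sym (*-identityˡ _)
  det-move rs P v (x ∷ Q) S = begin
    det rs (P ++ v ∷ x ∷ (Q ++ S))                              ≈⟨ det-swap rs P v x (Q ++ S) ⟩
    - det rs (P ++ x ∷ v ∷ (Q ++ S))                            ≈⟨ -‿cong (det-≡ rs (≡.sym (Listₚ.++-assoc P [ x ] (v ∷ (Q ++ S))))) ⟩
    - det rs ((P ++ [ x ]) ++ v ∷ (Q ++ S))                     ≈⟨ -‿cong (det-move rs (P ++ [ x ]) v Q S) ⟩
    - (sign (length Q) * det rs ((P ++ [ x ]) ++ Q ++ v ∷ S))   ≈⟨ -‿distribˡ-* _ _ ⟩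
    - sign (length Q) * det rs ((P ++ [ x ]) ++ Q ++ v ∷ S)     ≈⟨ *-congˡ (det-≡ rs (Listₚ.++-assoc P [ x ] (Q ++ v ∷ S))) ⟩
    - sign (length Q) * det rs (P ++ x ∷ Q ++ v ∷ S)            ∎

  det-dup-head : ∀ rs v Q S → det rs (v ∷ (Q ++ v ∷ S)) ≈ 0#
  det-dup-head rs v Q S = trans (det-move rs [] v Q (v ∷ S)) (trans (*-congˡ (det-dup rs Q v S)) (zeroʳ _))

binom2-+ : ∀ k d → binom2 (+ (k ℕ.+ d) - + k) ≡ d C 2
binom2-+ k d = ≡.cong binom2 (≡.trans (ℤₚ.[+m]-[+n]≡m⊖n (k ℕ.+ d) k)
  (≡.trans (ℤₚ.⊖-≥ (ℕₚ.m≤m+n k d)) (≡.cong +_ (ℕₚ.m+n∸m≡n k d))))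

binom2-self : ∀ a → binom2 (+ a - + a) ≡ 0
binom2-self a = ≡.cong binom2 (≡.trans (ℤₚ.[+m]-[+n]≡m⊖n a a) (ℤₚ.n⊖n≡0 a))

binom2-suc-suc : ∀ a b → binom2 (+ suc a - + suc b) ≡ binom2 (+ a - + b)
binom2-suc-suc a b = ≡.cong binom2 (≡.trans (ℤₚ.[+m]-[+n]≡m⊖n (suc a) (suc b))
  (≡.trans (ℤₚ.[1+m]⊖[1+n]≡m⊖n a b) (≡.sym (ℤₚ.[+m]-[+n]≡m⊖n a b))))

suc-C-2 : ∀ d → suc d C 2 ≡ d ℕ.+ d C 2
suc-C-2 d = ≡.trans (≡.sym (nCk+nC[k+1]≡[n+1]C[k+1] d 1)) (≡.cong (ℕ._+ d C 2) (nC1≡n d))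

binom2-step₀ : ∀ a → binom2 (+ suc a - + 0) ≡ a ℕ.+ binom2 (+ a - + 0)
binom2-step₀ a = ≡.trans (binom2-+ 0 (suc a)) (≡.trans (suc-C-2 a) (≡.cong (a ℕ.+_) (≡.sym (binom2-+ 0 a))))

binom2-step : ∀ {a b} → b < a → binom2 (+ a - + b) ℕ.+ suc b ≡ a ℕ.+ binom2 (+ a - + suc b)
binom2-step {a} {b} b<a with a ℕ.∸ suc b | ℕₚ.m+[n∸m]≡n b<a
... | d | ≡.refl = begin
  binom2 (+ suc (b ℕ.+ d) - + b) ℕ.+ suc b ≡⟨ ≡.cong (λ k → binom2 (+ k - + b) ℕ.+ suc b) (≡.sym (ℕₚ.+-suc b d)) ⟩
  binom2 (+ (b ℕ.+ suc d) - + b) ℕ.+ suc b ≡⟨ ≡.cong (ℕ._+ suc b) (≡.trans (binom2-+ b (suc d)) (suc-C-2 d)) ⟩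
  (d ℕ.+ d C 2) ℕ.+ suc b                  ≡⟨ ℕₚ.+-comm (d ℕ.+ d C 2) (suc b) ⟩
  suc b ℕ.+ (d ℕ.+ d C 2)                  ≡⟨ ≡.sym (ℕₚ.+-assoc (suc b) d (d C 2)) ⟩
  (suc b ℕ.+ d) ℕ.+ d C 2                  ≡⟨ ≡.cong ((suc b ℕ.+ d) ℕ.+_) (≡.sym (binom2-+ (suc b) d)) ⟩
  (suc b ℕ.+ d) ℕ.+ binom2 (+ (suc b ℕ.+ d) - + suc b) ∎
  where open ≡.≡-Reasoning

module QPascal {c ℓ : Level} (R : CommutativeRing c ℓ) (q : CommutativeRing.Carrier R) where
  open CommutativeRing R hiding (zero; _-_)
  open import Relation.Binary.Reasoning.Setoid setoid
  open RingSolver R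
  open Signs R
  open Sums R

  qbin : ℕ → ℕ → Carrier
  qbin = qbinom R q

  q^_ : ℕ → Carrier
  q^_ = pow R q

  q^-+ : ∀ m n → q^ (m ℕ.+ n) ≈ q^ m * q^ n
  q^-+ zero    n = sym (*-identityˡ _)
  q^-+ (suc m) n = trans (*-congˡ (q^-+ m n)) (sym (*-assoc _ _ _))

  q^-≡ : ∀ {m n} → m ≡ n → q^ m ≈ q^ n
  q^-≡ e = reflexive (≡.cong q^_ e)

  qbin-< : ∀ {m k} → m < k → qbin m k ≈ 0#
  qbin-< {zero}  {suc k} _         = refl
  qbin-< {suc m} {suc k} (s≤s m<k) = trans
    (+-cong (qbin-< m<k) (*-congˡ (qbin-< (ℕₚ.m<n⇒m<1+n m<k))))
    (solve 1 (λ x → con (+ 0) :+ x :* con (+ 0) := con (+ 0)) refl _)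

  qbin-diag : ∀ m → qbin m m ≈ 1#
  qbin-diag zero    = refl
  qbin-diag (suc m) = trans (+-cong (qbin-diag m) (*-congˡ (qbin-< (ℕₚ.n<1+n m))))
    (trans (+-congˡ (zeroʳ _)) (+-identityʳ _))

  twisted : ℕ → ℕ → Carrier
  twisted a b = q^ binom2 (+ a - + b) * qbin a b

  twisted-diag : ∀ a → twisted a a ≈ 1#
  twisted-diag a = trans (*-cong (q^-≡ (binom2-self a)) (qbin-diag a)) (*-identityˡ _)

  twisted-< : ∀ {a b} → a < b → twisted a b ≈ 0#
  twisted-< a<b = trans (*-congˡ (qbin-< a<b)) (zeroʳ _)

  twisted-suc-zero : ∀ a → twisted (suc a) 0 ≈ q^ a * twisted a 0
  twisted-suc-zero a = begin
    q^ binom2 (+ suc a - + 0) * 1#          ≈⟨ *-congʳ (trans (q^-≡ (binom2-step₀ a)) (q^-+ a _)) ⟩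
    (q^ a * q^ binom2 (+ a - + 0)) * 1#     ≈⟨ *-assoc _ _ _ ⟩
    q^ a * twisted a 0                      ∎

  twisted-suc-suc : ∀ a b → twisted (suc a) (suc b) ≈ twisted a b + q^ a * twisted a (suc b)
  twisted-suc-suc a b = begin
    q^ E * (qbin a b + q^ suc b * qbin a (suc b))
      ≈⟨ trans (distribˡ _ _ _) (+-congˡ (sym (*-assoc _ _ _))) ⟩
    q^ E * qbin a b + (q^ E * q^ suc b) * qbin a (suc b)
      ≈⟨ +-cong (*-congʳ (q^-≡ (binom2-suc-suc a b))) second ⟩
    twisted a b + q^ a * twisted a (suc b) ∎
    where
    E = binom2 (+ suc a - + suc b)
    second : (q^ E * q^ suc b) * qbin a (suc b) ≈ q^ a * twisted a (suc b)
    second with b <? a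
    ... | yes b<a = trans (*-congʳ (begin
            q^ E * q^ suc b                          ≈⟨ sym (q^-+ E (suc b)) ⟩
            q^ (E ℕ.+ suc b)                         ≡⟨ ≡.cong (λ e → q^ (e ℕ.+ suc b)) (binom2-suc-suc a b) ⟩
            q^ (binom2 (+ a - + b) ℕ.+ suc b)        ≡⟨ ≡.cong q^_ (binom2-step b<a) ⟩
            q^ (a ℕ.+ binom2 (+ a - + suc b))        ≈⟨ q^-+ a _ ⟩
            q^ a * q^ binom2 (+ a - + suc b)         ∎)) (*-assoc _ _ _)
    ... | no b≮a = trans (trans (*-congˡ (qbin-< a<1+b)) (zeroʳ _))
                         (sym (trans (*-congˡ (twisted-< a<1+b)) (zeroʳ _)))
      where
      a<1+b : a < suc b
      a<1+b = s≤s (ℕₚ.≮⇒≥ b≮a)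

  δ : ℕ → ℕ → Carrier
  δ zero    zero    = 1#
  δ zero    (suc b) = 0#
  δ (suc a) zero    = 0#
  δ (suc a) (suc b) = δ a b

  δ-< : ∀ {a s} → s < a → δ a s ≈ 0#
  δ-< {suc a} {zero}  _         = refl
  δ-< {suc a} {suc s} (s≤s s<a) = δ-< s<a

  q^-δ : ∀ a b → q^ b * δ a b ≈ q^ a * δ a b
  q^-δ zero    zero    = refl
  q^-δ zero    (suc b) = trans (zeroʳ _) (sym (zeroʳ _))
  q^-δ (suc a) zero    = trans (zeroʳ _) (sym (zeroʳ _))
  q^-δ (suc a) (suc b) = trans (*-assoc _ _ _) (trans (*-congˡ (q^-δ a b)) (sym (*-assoc _ _ _)))

  qPascalInverse : ℕ → ℕ → Carrier
  qPascalInverse a b = (sign a * sign b) * twisted a b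

  qPascalInverse-suc-zero : ∀ a → qPascalInverse (suc a) 0 ≈ - (q^ a * qPascalInverse a 0)
  qPascalInverse-suc-zero a = begin
    (- sign a * 1#) * twisted (suc a) 0      ≈⟨ *-congˡ (twisted-suc-zero a) ⟩
    (- sign a * 1#) * (q^ a * twisted a 0)
      ≈⟨ solve 4 (λ x y p t → ((:- x) :* y) :* (p :* t) := :- (p :* ((x :* y) :* t))) refl _ _ _ _ ⟩
    - (q^ a * qPascalInverse a 0)            ∎

  qPascalInverse-suc-suc : ∀ a b →
    qPascalInverse (suc a) (suc b) ≈ qPascalInverse a b + - (q^ a * qPascalInverse a (suc b))
  qPascalInverse-suc-suc a b = begin
    (- sign a * - sign b) * twisted (suc a) (suc b)
      ≈⟨ *-congˡ (twisted-suc-suc a b) ⟩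
    (- sign a * - sign b) * (twisted a b + q^ a * twisted a (suc b))
      ≈⟨ solve 5 (λ x y t p t′ → ((:- x) :* (:- y)) :* (t :+ p :* t′) := (x :* y) :* t :+ :- (p :* ((x :* (:- y)) :* t′))) refl _ _ _ _ _ ⟩
    qPascalInverse a b + - (q^ a * qPascalInverse a (suc b)) ∎

  qPascalInverse-row-suc : ∀ a n (g : ℕ → Carrier) →
    sumFrom 0 (suc n) (λ b → qPascalInverse (suc a) b * g b) ≈
    sumFrom 0 n (λ b → qPascalInverse a b * g (suc b)) + (- q^ a) * sumFrom 0 (suc n) (λ b → qPascalInverse a b * g b)
  qPascalInverse-row-suc a n g = begin
    qPascalInverse (suc a) 0 * g 0 + sumFrom 1 n (λ b → qPascalInverse (suc a) b * g b)
      ≈⟨ +-cong (*-congʳ (qPascalInverse-suc-zero a)) (trans (reflexive (sumFrom-suc 0 n _))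
           (sumFrom-cong 0 n (λ b _ → *-congʳ (qPascalInverse-suc-suc a b)))) ⟩
    - (q^ a * c₀) * g 0 + sumFrom 0 n (λ b → (qPascalInverse a b + - (q^ a * qPascalInverse a (suc b))) * g (suc b))
      ≈⟨ +-congˡ (trans (sumFrom-cong 0 n (λ b _ → solve 4 (λ x p y z → (x :+ :- (p :* y)) :* z := x :* z :+ (:- p) :* (y :* z)) refl _ _ _ _))
           (trans (sumFrom-+ 0 n _ _) (+-congˡ (sumFrom-*ˡ 0 n _ _)))) ⟩
    - (q^ a * c₀) * g 0 + (T + (- q^ a) * S)
      ≈⟨ solve 5 (λ p c t g₀ s → :- (p :* c) :* g₀ :+ (t :+ (:- p) :* s) := t :+ (:- p) :* (c :* g₀ :+ s)) refl _ _ _ _ _ ⟩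
    T + (- q^ a) * (c₀ * g 0 + S)
      ≈⟨ +-congˡ (*-congˡ (+-congˡ (reflexive (≡.sym (sumFrom-suc 0 n _))))) ⟩
    T + (- q^ a) * sumFrom 0 (suc n) (λ b → qPascalInverse a b * g b) ∎
    where
    c₀ = qPascalInverse a 0
    T  = sumFrom 0 n (λ b → qPascalInverse a b * g (suc b))
    S  = sumFrom 0 n (λ b → qPascalInverse a (suc b) * g (suc b))

  qPascalInverse-inverseˡ : ∀ a n s → a < n → sumFrom 0 n (λ b → qPascalInverse a b * qbin b s) ≈ δ a s
  qPascalInverse-inverseˡ zero (suc n) s _ = begin
    qPascalInverse 0 0 * qbin 0 s + sumFrom 1 n (λ b → qPascalInverse 0 b * qbin b s)
      ≈⟨ +-cong (trans (*-congʳ (*-congʳ (*-identityˡ 1#))) (trans (*-congʳ (*-identityˡ _)) (*-congʳ (twisted-diag 0))))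
                (trans (reflexive (sumFrom-suc 0 n _))
                       (sumFrom-zero 0 n _ (λ b _ → trans (*-congʳ (*-congˡ (twisted-< {0} {suc b} (s≤s z≤n)))) (trans (*-congʳ (zeroʳ _)) (zeroˡ _))))) ⟩
    1# * qbin 0 s + 0#  ≈⟨ trans (+-identityʳ _) (*-identityˡ _) ⟩
    qbin 0 s            ≈⟨ qbin-zero s ⟩
    δ 0 s               ∎
    where
    qbin-zero : ∀ s → qbin 0 s ≈ δ 0 s
    qbin-zero zero    = refl
    qbin-zero (suc s) = refl
  qPascalInverse-inverseˡ (suc a) (suc n) s (s≤s a<n) = begin
    sumFrom 0 (suc n) (λ b → qPascalInverse (suc a) b * qbin b s)
      ≈⟨ qPascalInverse-row-suc a n (λ b → qbin b s) ⟩
    sumFrom 0 n (λ b → qPascalInverse a b * qbin (suc b) s) + (- q^ a) * sumFrom 0 (suc n) (λ b → qPascalInverse a b * qbin b s)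
      ≈⟨ +-congˡ (*-congˡ (qPascalInverse-inverseˡ a (suc n) s (ℕₚ.m<n⇒m<1+n a<n))) ⟩
    sumFrom 0 n (λ b → qPascalInverse a b * qbin (suc b) s) + (- q^ a) * δ a s
      ≈⟨ shifted s ⟩
    δ (suc a) s ∎
    where
    row : ∀ s → sumFrom 0 n (λ b → qPascalInverse a b * qbin b s) ≈ δ a s
    row s = qPascalInverse-inverseˡ a n s a<n
    shifted : ∀ s → sumFrom 0 n (λ b → qPascalInverse a b * qbin (suc b) s) + (- q^ a) * δ a s ≈ δ (suc a) s
    shifted zero = trans (+-congʳ (row 0)) (cancel a)
      where
      cancel : ∀ a → δ a 0 + (- q^ a) * δ a 0 ≈ δ (suc a) 0
      cancel zero    = trans (+-congˡ (*-identityʳ _)) (-‿inverseʳ 1#)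
      cancel (suc a) = trans (+-identityˡ _) (zeroʳ _)
    shifted (suc s) = begin
      sumFrom 0 n (λ b → qPascalInverse a b * (qbin b s + q^ suc s * qbin b (suc s))) + (- q^ a) * δ a (suc s)
        ≈⟨ +-congʳ (trans (sumFrom-cong 0 n (λ b _ → solve 4 (λ x y p z → x :* (y :+ p :* z) := x :* y :+ p :* (x :* z)) refl _ _ _ _))
                    (trans (sumFrom-+ 0 n _ _) (+-cong (row s) (trans (sumFrom-*ˡ 0 n _ _) (*-congˡ (row (suc s))))))) ⟩
      (δ a s + q^ suc s * δ a (suc s)) + (- q^ a) * δ a (suc s)
        ≈⟨ +-congʳ (+-congˡ (q^-δ a (suc s))) ⟩
      (δ a s + q^ a * δ a (suc s)) + (- q^ a) * δ a (suc s)
        ≈⟨ solve 3 (λ d p e → (d :+ p :* e) :+ (:- p) :* e := d) refl _ _ _ ⟩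
      δ a s ∎

  columnWeight : ℕ → ℕ → Carrier
  columnWeight s b = sign (b ℕ.∸ suc s) * qbin b s

  private
    cancel-unit : ∀ y x z → y * y ≈ 1# → y * x + (- y) * z ≈ 0# → x ≈ z
    cancel-unit y x z y²≈1 e = begin
      x                                   ≈⟨ sym (trans (*-congʳ y²≈1) (*-identityˡ x)) ⟩
      (y * y) * x                         ≈⟨ solve 3 (λ y x z → (y :* y) :* x := y :* (y :* x :+ (:- y) :* z) :+ (y :* y) :* z) refl _ _ _ ⟩
      y * (y * x + (- y) * z) + (y * y) * z ≈⟨ +-cong (trans (*-congˡ e) (zeroʳ y)) (trans (*-congʳ y²≈1) (*-identityˡ z)) ⟩
      0# + z                              ≈⟨ +-identityˡ z ⟩
      z                                   ∎

  -- Entry (a, s) of the left-inverse identity, with s < a, split into the terms b < s, b = s and b > s.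
  twisted-column : ∀ s k a → s < a → a < suc s ℕ.+ k →
    twisted a s ≈ sumFrom (suc s) k (λ b → columnWeight s b * twisted a b)
  twisted-column s k a s<a a<1+s+k = cancel-unit y (twisted a s) later y²≈1 (begin
    y * twisted a s + (- y) * later                  ≈⟨ sym (+-identityˡ _) ⟩
    0# + (y * twisted a s + (- y) * later)           ≈⟨ +-cong (sym earlier≈0) (+-cong diagonal (sym later≈)) ⟩
    sumFrom 0 s g + sumFrom s (suc k) g              ≈⟨ sym (sumFrom-split s 0 (suc k) g) ⟩
    sumFrom 0 (s ℕ.+ suc k) g                        ≈⟨ qPascalInverse-inverseˡ a (s ℕ.+ suc k) s a<s+1+k ⟩
    δ a s                                            ≈⟨ δ-< s<a ⟩
    0#                                               ∎)
    where
    y = sign a * sign s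
    g = λ b → qPascalInverse a b * qbin b s
    later = sumFrom (suc s) k (λ b → columnWeight s b * twisted a b)

    y²≈1 : y * y ≈ 1#
    y²≈1 = trans (solve 2 (λ x z → (x :* z) :* (x :* z) := (x :* x) :* (z :* z)) refl _ _)
                 (trans (*-cong (sign-square a) (sign-square s)) (*-identityˡ _))

    a<s+1+k : a < s ℕ.+ suc k
    a<s+1+k = ≡.subst (a <_) (≡.sym (ℕₚ.+-suc s k)) a<1+s+k

    earlier≈0 : sumFrom 0 s g ≈ 0#
    earlier≈0 = sumFrom-zero 0 s g (λ b b<s → trans (*-congˡ (qbin-< b<s)) (zeroʳ _))

    diagonal : y * twisted a s ≈ g s
    diagonal = sym (trans (*-congˡ (qbin-diag s)) (*-identityʳ _))

    later≈ : sumFrom (suc s) k g ≈ (- y) * later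
    later≈ = trans (sumFrom-cong (suc s) k term) (sumFrom-*ˡ (suc s) k _ _)
      where
      term : ∀ b → suc s ≤ b → g b ≈ (- y) * (columnWeight s b * twisted a b)
      term b s<b = begin
        ((sign a * sign b) * twisted a b) * qbin b s
          ≈⟨ *-congʳ (*-congʳ (*-congˡ (trans (reflexive (≡.cong sign (≡.sym (ℕₚ.m+[n∸m]≡n s<b)))) (sign-+ (suc s) _)))) ⟩
        ((sign a * (- sign s * sign (b ℕ.∸ suc s))) * twisted a b) * qbin b s
          ≈⟨ solve 5 (λ x z t n p → ((x :* ((:- z) :* t)) :* n) :* p := (:- (x :* z)) :* ((t :* p) :* n)) refl _ _ _ _ _ ⟩
        (- y) * (columnWeight s b * twisted a b) ∎

elemsFrom : ∀ {k} → ℕ → Subset k → List ℕ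
elemsFrom s []          = []
elemsFrom s (true ∷ p)  = s ∷ elemsFrom (suc s) p
elemsFrom s (false ∷ p) = elemsFrom (suc s) p

length-elemsFrom : ∀ {k} s (p : Subset k) → length (elemsFrom s p) ≡ ∣ p ∣
length-elemsFrom s []          = ≡.refl
length-elemsFrom s (true ∷ p)  = ≡.cong suc (length-elemsFrom (suc s) p)
length-elemsFrom s (false ∷ p) = length-elemsFrom (suc s) p

map-suc-elemsFrom : ∀ {k} s (p : Subset k) → map suc (elemsFrom s p) ≡ elemsFrom (suc s) p
map-suc-elemsFrom s []          = ≡.refl
map-suc-elemsFrom s (true ∷ p)  = ≡.cong (suc s ∷_) (map-suc-elemsFrom (suc s) p)
map-suc-elemsFrom s (false ∷ p) = map-suc-elemsFrom (suc s) p

elems≡elemsFrom : ∀ {k} (p : Subset k) → elems p ≡ elemsFrom 0 p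
elems≡elemsFrom []          = ≡.refl
elems≡elemsFrom (true ∷ p)  = ≡.cong (0 ∷_) (≡.trans (≡.cong (map suc) (elems≡elemsFrom p)) (map-suc-elemsFrom 0 p))
elems≡elemsFrom (false ∷ p) = ≡.trans (≡.cong (map suc) (elems≡elemsFrom p)) (map-suc-elemsFrom 0 p)

InRange : ℕ → ℕ → ℕ → Set
InRange u j r = u ≤ r × r < u ℕ.+ j

InRange-suc : ∀ u j {r} → InRange (suc u) j r → InRange u (suc j) r
InRange-suc u j {r} (u<r , r<) = ℕₚ.<⇒≤ u<r , ≡.subst (r <_) (≡.sym (ℕₚ.+-suc u j)) r<

elemsFrom-inRange : ∀ {j} u (p : Subset j) → All (InRange u j) (elemsFrom u p)
elemsFrom-inRange         u []          = []
elemsFrom-inRange {suc j} u (true ∷ p)  =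
  (ℕₚ.≤-refl , ℕₚ.m<m+n u (s≤s z≤n)) ∷ All.map (InRange-suc u j) (elemsFrom-inRange (suc u) p)
elemsFrom-inRange {suc j} u (false ∷ p) = All.map (InRange-suc u j) (elemsFrom-inRange (suc u) p)

length-elems : ∀ {k} (p : Subset k) → length (elems p) ≡ ∣ p ∣
length-elems p = ≡.trans (≡.cong length (elems≡elemsFrom p)) (length-elemsFrom 0 p)

module Complement {c ℓ : Level} (R : CommutativeRing c ℓ) (q : CommutativeRing.Carrier R) where
  open CommutativeRing R hiding (zero; _-_)
  open import Relation.Binary.Reasoning.Setoid setoid
  open RingSolver R
  open Signs R
  open Sums R
  open Determinant R ℕ
  open QPascal R q

  column : (ℕ → ℕ → Carrier) → ℕ → Column
  column f b a = f a b

  mutual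
    detL≈det : ∀ f rs cs → length rs ≡ length cs → detL R f rs cs ≈ det rs (map (column f) cs)
    detL≈det f []       []  _ = refl
    detL≈det f (r ∷ rs) cs  e = lap≈expand f r rs [] cs e

    lap≈expand : ∀ f r rs P Q → suc (length rs) ≡ length P ℕ.+ length Q →
      lap R f r rs P Q ≈ expand r rs (map (column f) P) (map (column f) Q)
    lap≈expand f r rs P []      e = refl
    lap≈expand f r rs P (x ∷ Q) e = +-cong
      (*-congˡ (trans (detL≈det f rs (P ++ Q) e₁) (det-≡ rs (Listₚ.map-++ (column f) P Q))))
      (-‿cong (trans (lap≈expand f r rs (P ++ [ x ]) Q e₂) (expand-≡ r rs (map (column f) Q) (Listₚ.map-++ (column f) P [ x ]))))
      where
      e₁ : length rs ≡ length (P ++ Q)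
      e₁ = ℕₚ.suc-injective (≡.trans e (≡.trans (ℕₚ.+-suc (length P) (length Q))
             (≡.cong suc (≡.sym (Listₚ.length-++ P)))))
      e₂ : suc (length rs) ≡ length (P ++ [ x ]) ℕ.+ length Q
      e₂ = ≡.trans e (≡.trans (ℕₚ.+-suc (length P) (length Q))
             (≡.cong (ℕ._+ length Q) (≡.trans (ℕₚ.+-comm 1 (length P)) (≡.sym (Listₚ.length-++ P)))))

  pascalColumn : ℕ → Column
  pascalColumn = column (λ a b → qbin b a)

  twistedColumn : ℕ → Column
  twistedColumn = column twisted

  private
    rearrange : ∀ x y a d r → x * x ≈ 1# → y * y ≈ 1# → a * d + - ((- x) * r) ≈ x * (((x * y) * a) * (y * d) + r)
    rearrange x y a d r x²≈1 y²≈1 = sym (begin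
      x * (((x * y) * a) * (y * d) + r)
        ≈⟨ solve 5 (λ x y a d r → x :* (((x :* y) :* a) :* (y :* d) :+ r) := ((x :* x) :* (y :* y)) :* (a :* d) :+ x :* r) refl _ _ _ _ _ ⟩
      ((x * x) * (y * y)) * (a * d) + x * r  ≈⟨ +-congʳ (trans (*-congʳ (trans (*-cong x²≈1 y²≈1) (*-identityˡ _))) (*-identityˡ _)) ⟩
      a * d + x * r                          ≈⟨ solve 3 (λ z x r → z :+ x :* r := z :+ :- ((:- x) :* r)) refl _ _ _ ⟩
      a * d + - ((- x) * r)                  ∎)

  -- Expansion of the Pascal minor along its row s, matched term by term with the twisted minor.
  -- The positions s+1, …, u-1 already passed are n elements of B (the columns passedP) and the
  -- elements passedT of ∁ B; X is the part of B from u on.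
  module FirstRow (s : ℕ) (rowsP rowsT : List ℕ) (K : ℕ) where
    expand≈sum : ∀ j (X : Subset j) u (passedP passedT : List ℕ) n →
      (∀ (Y : Subset j) → n ℕ.+ ∣ Y ∣ ≡ K →
         det rowsP (map pascalColumn (passedP ++ elemsFrom u Y)) ≈ det rowsT (map twistedColumn (passedT ++ elemsFrom u (∁ Y)))) →
      n ℕ.+ ∣ X ∣ ≡ suc K → n ℕ.+ length passedT ℕ.+ suc s ≡ u →
      expand s rowsP (map pascalColumn passedP) (map pascalColumn (elemsFrom u X)) ≈
        sign n * sumFrom u j (λ b → columnWeight s b * det rowsT (twistedColumn b ∷ map twistedColumn (passedT ++ elemsFrom u (∁ X))))
    expand≈sum zero    []          u passedP passedT n minors |X| pos = sym (zeroʳ _)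
    expand≈sum (suc j) (false ∷ X) u passedP passedT n minors |X| pos = begin
      expand s rowsP (map pascalColumn passedP) (map pascalColumn (elemsFrom (suc u) X))
        ≈⟨ expand≈sum j X (suc u) passedP (passedT ++ [ u ]) n minors′ |X| pos′ ⟩
      sign n * sumFrom (suc u) j (λ b → columnWeight s b * det rowsT (twistedColumn b ∷ map twistedColumn ((passedT ++ [ u ]) ++ rest)))
        ≡⟨ ≡.cong (λ cs → sign n * sumFrom (suc u) j (λ b → columnWeight s b * det rowsT (twistedColumn b ∷ map twistedColumn cs)))
                  (Listₚ.++-assoc passedT [ u ] rest) ⟩
      sign n * sumFrom (suc u) j (λ b → columnWeight s b * det rowsT (twistedColumn b ∷ map twistedColumn (passedT ++ u ∷ rest)))
        ≈⟨ *-congˡ (sym (trans (+-congʳ (trans (*-congˡ repeated) (zeroʳ _))) (+-identityˡ _))) ⟩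
      sign n * (columnWeight s u * det rowsT (twistedColumn u ∷ map twistedColumn (passedT ++ u ∷ rest)) +
                sumFrom (suc u) j (λ b → columnWeight s b * det rowsT (twistedColumn b ∷ map twistedColumn (passedT ++ u ∷ rest)))) ∎
      where
      rest = elemsFrom (suc u) (∁ X)
      repeated : det rowsT (twistedColumn u ∷ map twistedColumn (passedT ++ u ∷ rest)) ≈ 0#
      repeated = trans (det-≡ rowsT (≡.cong (twistedColumn u ∷_) (Listₚ.map-++ twistedColumn passedT (u ∷ rest))))
                       (det-dup-head rowsT (twistedColumn u) (map twistedColumn passedT) (map twistedColumn rest))
      minors′ : ∀ (Y : Subset j) → n ℕ.+ ∣ Y ∣ ≡ K →
        det rowsP (map pascalColumn (passedP ++ elemsFrom (suc u) Y)) ≈ det rowsT (map twistedColumn ((passedT ++ [ u ]) ++ elemsFrom (suc u) (∁ Y)))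
      minors′ Y |Y| = trans (minors (false ∷ Y) |Y|)
        (det-≡ rowsT (≡.cong (map twistedColumn) (≡.sym (Listₚ.++-assoc passedT [ u ] (elemsFrom (suc u) (∁ Y))))))
      pos′ : n ℕ.+ length (passedT ++ [ u ]) ℕ.+ suc s ≡ suc u
      pos′ = ≡.trans (≡.cong (λ l → n ℕ.+ l ℕ.+ suc s) (≡.trans (Listₚ.length-++ passedT) (ℕₚ.+-comm (length passedT) 1)))
               (≡.trans (≡.cong (ℕ._+ suc s) (ℕₚ.+-suc n (length passedT))) (≡.cong suc pos))
    expand≈sum (suc j) (true ∷ X) u passedP passedT n minors |X| pos = begin
      qbin u s * det rowsP (map pascalColumn passedP ++ map pascalColumn (elemsFrom (suc u) X)) +
        - expand s rowsP (map pascalColumn passedP ++ [ pascalColumn u ]) (map pascalColumn (elemsFrom (suc u) X))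
        ≈⟨ +-cong (*-congˡ (trans (det-≡ rowsP (≡.sym (Listₚ.map-++ pascalColumn passedP (elemsFrom (suc u) X)))) minor))
                  (-‿cong (trans (expand-≡ s rowsP (map pascalColumn (elemsFrom (suc u) X)) (≡.sym (Listₚ.map-++ pascalColumn passedP [ u ])))
                                 (expand≈sum j X (suc u) (passedP ++ [ u ]) passedT (suc n) minors′ |X|′ (≡.cong suc pos)))) ⟩
      qbin u s * D + - (sign (suc n) * rest)
        ≈⟨ rearrange (sign n) (sign p) (qbin u s) D rest (sign-square n) (sign-square p) ⟩
      sign n * (((sign n * sign p) * qbin u s) * (sign p * D) + rest)
        ≈⟨ *-congˡ (+-congʳ (*-cong (*-congʳ (sym weightSign)) (sym moved))) ⟩
      sign n * (columnWeight s u * det rowsT (twistedColumn u ∷ map twistedColumn (passedT ++ restT)) + rest) ∎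
      where
      restT = elemsFrom (suc u) (∁ X)
      p     = length passedT
      D     = det rowsT (map twistedColumn (passedT ++ u ∷ restT))
      rest  = sumFrom (suc u) j (λ b → columnWeight s b * det rowsT (twistedColumn b ∷ map twistedColumn (passedT ++ restT)))

      minor : det rowsP (map pascalColumn (passedP ++ elemsFrom (suc u) X)) ≈ D
      minor = minors (false ∷ X) (ℕₚ.suc-injective (≡.trans (≡.sym (ℕₚ.+-suc n ∣ X ∣)) |X|))

      moved : det rowsT (twistedColumn u ∷ map twistedColumn (passedT ++ restT)) ≈ sign p * D
      moved = begin
        det rowsT (twistedColumn u ∷ map twistedColumn (passedT ++ restT))
          ≡⟨ ≡.cong (λ cs → det rowsT (twistedColumn u ∷ cs)) (Listₚ.map-++ twistedColumn passedT restT) ⟩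
        det rowsT (twistedColumn u ∷ (map twistedColumn passedT ++ map twistedColumn restT))
          ≈⟨ det-move rowsT [] (twistedColumn u) (map twistedColumn passedT) (map twistedColumn restT) ⟩
        sign (length (map twistedColumn passedT)) * det rowsT (map twistedColumn passedT ++ twistedColumn u ∷ map twistedColumn restT)
          ≡⟨ ≡.cong₂ (λ l cs → sign l * det rowsT cs) (Listₚ.length-map twistedColumn passedT)
                     (≡.sym (Listₚ.map-++ twistedColumn passedT (u ∷ restT))) ⟩
        sign p * D ∎

      weightSign : sign (u ℕ.∸ suc s) ≈ sign n * sign p
      weightSign = trans (reflexive (≡.cong sign (≡.trans (≡.cong (ℕ._∸ suc s) (≡.sym pos)) (ℕₚ.m+n∸n≡m (n ℕ.+ p) (suc s)))))
                         (sign-+ n p)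

      |X|′ : suc n ℕ.+ ∣ X ∣ ≡ suc K
      |X|′ = ≡.trans (≡.sym (ℕₚ.+-suc n ∣ X ∣)) |X|

      minors′ : ∀ (Y : Subset j) → suc n ℕ.+ ∣ Y ∣ ≡ K →
        det rowsP (map pascalColumn ((passedP ++ [ u ]) ++ elemsFrom (suc u) Y)) ≈ det rowsT (map twistedColumn (passedT ++ elemsFrom (suc u) (∁ Y)))
      minors′ Y |Y| = trans (det-≡ rowsP (≡.cong (map pascalColumn) (Listₚ.++-assoc passedP [ u ] (elemsFrom (suc u) Y))))
                            (minors (true ∷ Y) (≡.trans (ℕₚ.+-suc n ∣ Y ∣) |Y|))

  private
    pascalColumn-below : ∀ {k} s (A : Subset k) → All (λ r → pascalColumn s r ≈ 0#) (elemsFrom (suc s) A)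
    pascalColumn-below s A = All.map (λ r∈ → qbin-< (proj₁ r∈)) (elemsFrom-inRange (suc s) A)

    twistedColumns-row : ∀ {k} s (B : Subset k) → All (λ v → v s ≈ 0#) (map twistedColumn (elemsFrom (suc s) B))
    twistedColumns-row s B = map⁺ (All.map (λ b∈ → twisted-< (proj₁ b∈)) (elemsFrom-inRange (suc s) B))

  det-complement : ∀ k s (A B : Subset k) → ∣ A ∣ ≡ ∣ B ∣ →
    det (elemsFrom s A) (map pascalColumn (elemsFrom s B)) ≈ det (elemsFrom s (∁ A)) (map twistedColumn (elemsFrom s (∁ B)))
  det-complement zero    s []          []          _ = refl
  det-complement (suc k) s (true ∷ A)  (true ∷ B)  e = begin
    det (s ∷ elemsFrom (suc s) A) (pascalColumn s ∷ map pascalColumn (elemsFrom (suc s) B))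
      ≈⟨ det-headColumn s _ (pascalColumn s) _ (pascalColumn-below s A) ⟩
    qbin s s * det (elemsFrom (suc s) A) (map pascalColumn (elemsFrom (suc s) B))
      ≈⟨ trans (*-congʳ (qbin-diag s)) (*-identityˡ _) ⟩
    det (elemsFrom (suc s) A) (map pascalColumn (elemsFrom (suc s) B))
      ≈⟨ det-complement k (suc s) A B (ℕₚ.suc-injective e) ⟩
    det (elemsFrom (suc s) (∁ A)) (map twistedColumn (elemsFrom (suc s) (∁ B))) ∎
  det-complement (suc k) s (false ∷ A) (false ∷ B) e = sym (begin
    det (s ∷ elemsFrom (suc s) (∁ A)) (twistedColumn s ∷ map twistedColumn (elemsFrom (suc s) (∁ B)))
      ≈⟨ det-headRow s _ (twistedColumn s) _ (twistedColumns-row s (∁ B)) ⟩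
    twisted s s * det (elemsFrom (suc s) (∁ A)) (map twistedColumn (elemsFrom (suc s) (∁ B)))
      ≈⟨ trans (*-congʳ (twisted-diag s)) (*-identityˡ _) ⟩
    det (elemsFrom (suc s) (∁ A)) (map twistedColumn (elemsFrom (suc s) (∁ B)))
      ≈⟨ sym (det-complement k (suc s) A B e) ⟩
    det (elemsFrom (suc s) A) (map pascalColumn (elemsFrom (suc s) B)) ∎)
  det-complement (suc k) s (false ∷ A) (true ∷ B)  e = trans
    (det-zeroColumn (elemsFrom (suc s) A) (pascalColumn s) _ (pascalColumn-below s A))
    (sym (det-zeroRow s _ _ (twistedColumns-row s (∁ B))))
  det-complement (suc k) s (true ∷ A)  (false ∷ B) e = begin
    expand s (elemsFrom (suc s) A) [] (map pascalColumn (elemsFrom (suc s) B))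
      ≈⟨ FirstRow.expand≈sum s (elemsFrom (suc s) A) rowsT ∣ A ∣ k B (suc s) [] [] 0
           (λ Y |Y| → det-complement k (suc s) A Y (≡.sym |Y|)) (≡.sym e) ≡.refl ⟩
    1# * sumFrom (suc s) k (λ b → columnWeight s b * det rowsT (twistedColumn b ∷ colsT))
      ≈⟨ *-identityˡ _ ⟩
    sumFrom (suc s) k (λ b → columnWeight s b * det rowsT (twistedColumn b ∷ colsT))
      ≈⟨ sym (det-sum-head rowsT (suc s) k (columnWeight s) twistedColumn colsT) ⟩
    det rowsT ((λ a → sumFrom (suc s) k (λ b → columnWeight s b * twisted a b)) ∷ colsT)
      ≈⟨ sym (det-cong-head rowsT (twistedColumn s) _ colsT
               (All.map (λ (s<a , a<) → twisted-column s k _ s<a a<) (elemsFrom-inRange (suc s) (∁ A)))) ⟩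
    det rowsT (twistedColumn s ∷ colsT) ∎
    where
    rowsT = elemsFrom (suc s) (∁ A)
    colsT = map twistedColumn (elemsFrom (suc s) (∁ B))

corollary1p4 : ∀ {c ℓ : Level} (R : CommutativeRing c ℓ) (q : CommutativeRing.Carrier R)
    (n : ℕ) (A B : Subset (suc n)) → ∣ A ∣ ≡ ∣ B ∣ →
    CommutativeRing._≈_ R
    (detSub R (λ a b → qbinom R q b a) A B)
    (detSub R (λ a' b' → CommutativeRing._*_ R (pow R q (binom2 (+ a' - + b'))) (qbinom R q a' b')) (∁ A) (∁ B))
corollary1p4 R q n A B |A|≡|B| = begin
  detL R (λ a b → qbin b a) (elems A) (elems B)
    ≈⟨ detL≈det _ (elems A) (elems B) (lengths A B |A|≡|B|) ⟩
  det (elems A) (map pascalColumn (elems B))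
    ≡⟨ ≡.cong₂ (λ rs cs → det rs (map pascalColumn cs)) (elems≡elemsFrom A) (elems≡elemsFrom B) ⟩
  det (elemsFrom 0 A) (map pascalColumn (elemsFrom 0 B))
    ≈⟨ det-complement (suc n) 0 A B |A|≡|B| ⟩
  det (elemsFrom 0 (∁ A)) (map twistedColumn (elemsFrom 0 (∁ B)))
    ≡⟨ ≡.sym (≡.cong₂ (λ rs cs → det rs (map twistedColumn cs)) (elems≡elemsFrom (∁ A)) (elems≡elemsFrom (∁ B))) ⟩
  det (elems (∁ A)) (map twistedColumn (elems (∁ B)))
    ≈⟨ sym (detL≈det twisted (elems (∁ A)) (elems (∁ B)) (lengths (∁ A) (∁ B) |∁A|≡|∁B|)) ⟩
  detL R twisted (elems (∁ A)) (elems (∁ B)) ∎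
  where
  open CommutativeRing R using (sym)
  open import Relation.Binary.Reasoning.Setoid (CommutativeRing.setoid R)
  open Determinant R ℕ using (det)
  open QPascal R q using (qbin; twisted)
  open Complement R q

  lengths : ∀ (X Y : Subset (suc n)) → ∣ X ∣ ≡ ∣ Y ∣ → length (elems X) ≡ length (elems Y)
  lengths X Y |X|≡|Y| = ≡.trans (length-elems X) (≡.trans |X|≡|Y| (≡.sym (length-elems Y)))

  |∁A|≡|∁B| : ∣ ∁ A ∣ ≡ ∣ ∁ B ∣
  |∁A|≡|∁B| = ≡.trans (∣∁p∣≡n∸∣p∣ A) (≡.trans (≡.cong (suc n ℕ.∸_) |A|≡|B|) (≡.sym (∣∁p∣≡n∸∣p∣ B)))
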